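{- Let $a \geq 4$ be an integer and let $S$ be a nonempty set of positive integers each at most $a/2$. (1) If $S$ contains an integer coprime to $a$, then ${\rm ECN}(a_S, a-1)$ is isomorphic to ${\rm MN}(a, a-1)$; otherwise ${\rm ECN}(a_S, a-1)$ is isomorphic to ${\rm ECN}(a_S, a-2)$. (2) If $S$ contains an integer coprime to $a$, then ${\rm ECN}(a_S, a)$ is isomorphic to ${\rm MN}(a, a)$ (i.e. it can be regarded as one-pile nim); otherwise ${\rm ECN}(a_S, a)$ is isomorphic to ${\rm ECN}(a_S, a-2)$.
   Context: All games are impartial, under normal play (a player unable to move loses). A position of a game on $m$ piles $v_0,\dots,v_{m-1}$ is a tuple $(n_0,\dots,n_{m-1})$ of nonnegative integers, $n_i$ being the number of tokens in pile $v_i$. Extended circular nim ${\rm ECN}(m_S,k)$ (for positive integers $k\le m$ and a set $S$ of positive integers each at most $m/2$): the piles are arranged in a circle, indices taken mod $m$. A move consists of choosing $s\in S$, $i\in\{0,\dots,m-1\}$ and $j\in\{0,\dots,k-1\}$, and removing an arbitrary nonnegative number of tokens (at most the pile's content) from each pile $v_{(i+ts)\bmod m}$, $t=0,\dots,j$, with at least one token removed in total. (Equivalently, it is nim on the simplicial complex on $\{v_0,\dots,v_{m-1}\}$ whose faces are all subsets of the sets $\{v_i, v_{(i+s)\bmod m},\dots,v_{(i+js)\bmod m}\}$; empty piles still count as piles.) Moore's nim ${\rm MN}(m,k)$: $m$ piles; a move chooses at most $k$ piles and removes an arbitrary number of tokens from each chosen pile, at least one token in total. Two rulesets $\Gamma_1,\Gamma_2$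 are isomorphic if there is a bijection $f$ from the positions of $\Gamma_1$ to the positions of $\Gamma_2$ such that for positions $g_1,g_2$ of $\Gamma_1$, $g_2$ is an option (a position reachable in one move) of $g_1$ if and only if $f(g_2)$ is an option of $f(g_1)$. -}

module Defs where

open import Level using (Level; _⊔_)
open import Data.Nat using (ℕ; _+_; _*_; _≤_; _<_)
open import Data.Fin using (Fin; toℕ)
open import Data.Fin.Subset using (Subset; _∈_; ∣_∣)
open import Data.Vec using (Vec; lookup)
open import Data.Product using (Σ; ∃; ∃-syntax; _×_)
open import Relation.Binary.PropositionalEquality using (_≡_)
open import Function.Definitions using (Bijective)
open import Function.Bundles using (_⇔_)

Position : ℕ → Set
Position m = Vec ℕ m

Decreases : ∀ {m} → Position m → Position m → Set
Decreases {m} g g' =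
  ((p : Fin m) → lookup g' p ≤ lookup g p) × (∃[ p ] lookup g' p < lookup g p)

-- Pile p is one of v_{(i + t s) mod m}, t = 0..j.
-- (toℕ p ≡ (toℕ i + t*s) mod m, written out: since toℕ p < m this is
--  toℕ i + t * s ≡ toℕ p + q * m for some q.)
InProgression : ∀ {m} → (s : ℕ) → (i : Fin m) → (j : ℕ) → Fin m → Set
InProgression {m} s i j p =
  ∃[ t ] (t ≤ j × ∃[ q ] (toℕ i + t * s ≡ toℕ p + q * m))

ECNOption : (m : ℕ) → (S : ℕ → Set) → (k : ℕ) → Position m → Position m → Set
ECNOption m S k g g' =
  ∃[ s ] (S s × ∃[ i ] ∃[ j ] (j < k ×
    (Decreases g g' ×
     ((p : Fin m) → ¬≡ (lookup g' p) (lookup g p) → InProgression s i j p))))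
  where
    open import Relation.Nullary using (¬_)
    ¬≡ : ℕ → ℕ → Set
    ¬≡ x y = ¬ (x ≡ y)

MNOption : (m : ℕ) → (k : ℕ) → Position m → Position m → Set
MNOption m k g g' =
  ∃[ T ] (∣ T ∣ ≤ k × (Decreases g g' ×
    ((p : Fin m) → lookup g' p < lookup g p → p ∈ T)))

Isomorphic : ∀ {a b ℓ₁ ℓ₂} {P₁ : Set a} {P₂ : Set b} →
  (P₁ → P₁ → Set ℓ₁) → (P₂ → P₂ → Set ℓ₂) → Set (a ⊔ b ⊔ ℓ₁ ⊔ ℓ₂)
Isomorphic {P₁ = P₁} {P₂} opt₁ opt₂ =
  Σ (P₁ → P₂) λ f → Bijective _≡_ _≡_ f ×
    ((g₁ g₂ : P₁) → opt₁ g₁ g₂ ⇔ opt₂ (f g₁) (f g₂))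

-- All four isomorphisms are the identity on positions, so it suffices to show that the
-- option relations coincide. An ECN move changes only piles on a progression
-- i, i + s, …, i + j s (mod a), and fewer than a terms never cover all a piles. If s is
-- coprime to a, then t ↦ i + t s is a bijection of the residues mod a: a terms cover every
-- pile, and the a − 1 terms starting at x + s cover every pile except x. Hence ECN(a_S, a)
-- and ECN(a_S, a − 1) have exactly the moves of MN(a, a) and MN(a, a − 1). If no s ∈ S is
-- coprime to a, then a ∣ m s for m = a / gcd(s, a) ≤ a / 2 ≤ a − 2, so every progression
-- can be cut down to its first m terms, and ECN(a_S, k) has the moves of ECN(a_S, a − 2)
-- for every k ≥ a − 2.
module Submission where

open import Defs
open import Data.Nat using (ℕ; _+_; _*_; _≤_; _∸_)
open import Data.Nat.Coprimality using (Coprime)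
open import Data.Product using (∃-syntax; _×_)
open import Relation.Nullary using (¬_)

open import Algebra.Properties.CommutativeSemigroup using (x∙yz≈y∙xz)
open import Data.Fin using (Fin; zero; toℕ; fromℕ<; punchOut)
import Data.Fin as Fin
open import Data.Fin.Properties
  using (toℕ-fromℕ<; toℕ-injective; toℕ<n; fromℕ<-cong; punchOut-injective; injective⇒≤
        ; any?; ¬∀⟶∃¬)
open import Data.Fin.Subset using (Subset; _∈_; _∉_; ∣_∣; ⊤; ∁; ⁅_⁆)
open import Data.Fin.Subset.Properties
  using (_∈?_; ∈⊤; ∣⊤∣≡n; p⊆q⇒∣p∣≤∣q∣; x∉p⇒x∈∁p; x∈⁅y⁆⇒x≡y; ∣∁p∣≡n∸∣p∣; ∣⁅x⁆∣≡1)
open import Data.Nat using (zero; suc; s≤s; s≤s⁻¹; z≤n; z<s; _<_; NonZero; _%_; _/_)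
import Data.Nat.Coprimality as Coprimality
open import Data.Nat.Divisibility using (_∣_; divides; ∣m+n∣m⇒∣n; n∣m*n; ∣n⇒∣m*n; n∣m⇒m%n≡0)
open import Data.Nat.DivMod
  using (_mod_; m≡m%n+[m/n]*n; [m+kn]%n≡m%n; m<n⇒m%n≡m; m%n<n; m%n%n≡m%n; %-distribˡ-+; %-remove-+ʳ)
open import Data.Nat.GCD using (gcd; gcd[m,n]∣m; gcd[m,n]∣n; gcd[m,n]≡0⇒n≡0)
open import Data.Nat.Properties
  using (≤-refl; ≤-reflexive; ≤-trans; ≤-<-trans; ≤-total; <⇒≢; >⇒≢; <⇒≱; ≤∧≢⇒<; 1+n≰n
        ; n≢0⇒n>0; n≤1+n; n<1+n; m≤n+m; m∸n≤m; m+[n∸m]≡n; +-comm; +-assoc; +-identityʳ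
        ; +-cancelˡ-≡; +-cancelˡ-≤; +-monoʳ-≤; *-comm; *-assoc; *-distribʳ-+; *-monoˡ-≤
        ; *-commutativeSemigroup; _≟_; module ≤-Reasoning)
open import Data.Product using (_,_; proj₁; proj₂)
open import Data.Sum using ([_,_]′)
open import Data.Vec using (lookup)
open import Function using (_∘_; id)
open import Function.Bundles using (_⇔_; mk⇔; Equivalence)
open import Function.Construct.Identity using (bijective)
open import Function.Definitions using (Injective)
open import Relation.Binary.PropositionalEquality
open import Relation.Nullary using (yes; no; contradiction)

injective⇒surjective : ∀ {n} {f : Fin n → Fin n} → Injective _≡_ _≡_ f → ∀ y → ∃[ x ] f x ≡ y
injective⇒surjective {suc n} {f} f-inj y with any? (λ x → f x Fin.≟ y)
... | yes hit = hit
... | no miss = contradiction (injective⇒≤ g-inj) 1+n≰n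
  where
  y≢f : ∀ x → y ≢ f x
  y≢f x y≡fx = miss (x , sym y≡fx)
  g : Fin (suc n) → Fin n
  g x = punchOut (y≢f x)
  g-inj : Injective _≡_ _≡_ g
  g-inj {x} {x′} = f-inj ∘ punchOut-injective (y≢f x) (y≢f x′)

surjective⇒≤ : ∀ {m n} {f : Fin m → Fin n} → (∀ y → ∃[ x ] f x ≡ y) → n ≤ m
surjective⇒≤ {f = f} f-surj = injective⇒≤ section-inj
  where
  section-inj : Injective _≡_ _≡_ (proj₁ ∘ f-surj)
  section-inj {y} {y′} eq = begin
    y                     ≡⟨ proj₂ (f-surj y) ⟨
    f (proj₁ (f-surj y))  ≡⟨ cong f eq ⟩
    f (proj₁ (f-surj y′)) ≡⟨ proj₂ (f-surj y′) ⟩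
    y′                    ∎
    where open ≡-Reasoning

m+[n+o]*p≡m+n*p+o*p : ∀ m p n o → m + (n + o) * p ≡ m + n * p + o * p
m+[n+o]*p≡m+n*p+o*p m p n o =
  trans (cong (m +_) (*-distribʳ-+ p n o)) (sym (+-assoc m (n * p) (o * p)))

module _ {a : ℕ} .{{_ : NonZero a}} where
  open ≡-Reasoning

  toℕ-mod : ∀ x → toℕ (x mod a) ≡ x % a
  toℕ-mod x = toℕ-fromℕ< (m%n<n x a)

  mod-cong : ∀ {x y} → x % a ≡ y % a → x mod a ≡ y mod a
  mod-cong {x} {y} eq = fromℕ<-cong _ _ eq (m%n<n x a) (m%n<n y a)

  mod≡⇔ : ∀ x (p : Fin a) → (x mod a ≡ p) ⇔ (∃[ q ] (x ≡ toℕ p + q * a))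
  mod≡⇔ x p = mk⇔ to from
    where
    to : x mod a ≡ p → ∃[ q ] (x ≡ toℕ p + q * a)
    to refl = x / a , trans (m≡m%n+[m/n]*n x a) (cong (_+ x / a * a) (sym (toℕ-mod x)))
    from : ∃[ q ] (x ≡ toℕ p + q * a) → x mod a ≡ p
    from (q , refl) = toℕ-injective (begin
      toℕ ((toℕ p + q * a) mod a) ≡⟨ toℕ-mod (toℕ p + q * a) ⟩
      (toℕ p + q * a) % a         ≡⟨ [m+kn]%n≡m%n (toℕ p) q a ⟩
      toℕ p % a                   ≡⟨ m<n⇒m%n≡m (toℕ<n p) ⟩
      toℕ p                       ∎)

  [m%d+n]%d≡[m+n]%d : ∀ m n → (m % a + n) % a ≡ (m + n) % a
  [m%d+n]%d≡[m+n]%d m n = begin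
    (m % a + n) % a           ≡⟨ %-distribˡ-+ (m % a) n a ⟩
    (m % a % a + n % a) % a   ≡⟨ cong (λ x → (x + n % a) % a) (m%n%n≡m%n m a) ⟩
    (m % a + n % a) % a       ≡⟨ %-distribˡ-+ m n a ⟨
    (m + n) % a               ∎

  [m+n]%d≡m%d⇒d∣n : ∀ m n → (m + n) % a ≡ m % a → a ∣ n
  [m+n]%d≡m%d⇒d∣n m n eq = ∣m+n∣m⇒∣n (divides ((m + n) / a) m/a*a+n≡[m+n]/a*a) (n∣m*n (m / a))
    where
    m/a*a+n≡[m+n]/a*a : m / a * a + n ≡ (m + n) / a * a
    m/a*a+n≡[m+n]/a*a = +-cancelˡ-≡ (m % a) _ _ (begin
      m % a + (m / a * a + n)   ≡⟨ +-assoc (m % a) _ n ⟨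
      m % a + m / a * a + n     ≡⟨ cong (_+ n) (m≡m%n+[m/n]*n m a) ⟨
      m + n                     ≡⟨ m≡m%n+[m/n]*n (m + n) a ⟩
      (m + n) % a + (m + n) / a * a ≡⟨ cong (_+ (m + n) / a * a) eq ⟩
      m % a + (m + n) / a * a   ∎)

  term : ℕ → Fin a → ℕ → Fin a
  term s i t = (toℕ i + t * s) mod a

  inProgression⇔ : ∀ {s i j p} → InProgression s i j p ⇔ (∃[ t ] (t ≤ j × term s i t ≡ p))
  inProgression⇔ {p = p} = mk⇔
    (λ (t , t≤j , eq) → t , t≤j , Equivalence.from (mod≡⇔ _ p) eq)
    (λ (t , t≤j , eq) → t , t≤j , Equivalence.to (mod≡⇔ _ p) eq)

  term-term : ∀ s i u t → term s (term s i u) t ≡ term s i (u + t)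
  term-term s i u t = mod-cong (begin
    (toℕ (term s i u) + t * s) % a      ≡⟨ cong (λ x → (x + t * s) % a) (toℕ-mod (toℕ i + u * s)) ⟩
    ((toℕ i + u * s) % a + t * s) % a   ≡⟨ [m%d+n]%d≡[m+n]%d (toℕ i + u * s) (t * s) ⟩
    (toℕ i + u * s + t * s) % a         ≡⟨ cong (_% a) (m+[n+o]*p≡m+n*p+o*p (toℕ i) s u t) ⟨
    (toℕ i + (u + t) * s) % a           ∎)

  term-periodic : ∀ {s m} .{{_ : NonZero m}} → a ∣ m * s → ∀ i t → term s i t ≡ term s i (t % m)
  term-periodic {s} {m} a∣m*s i t = mod-cong (begin
    (toℕ i + t * s) % a
      ≡⟨ cong (λ u → (toℕ i + u * s) % a) (m≡m%n+[m/n]*n t m) ⟩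
    (toℕ i + (t % m + t / m * m) * s) % a
      ≡⟨ cong (_% a) (m+[n+o]*p≡m+n*p+o*p (toℕ i) s (t % m) _) ⟩
    (toℕ i + t % m * s + t / m * m * s) % a
      ≡⟨ %-remove-+ʳ (toℕ i + t % m * s) a∣[t/m]*m*s ⟩
    (toℕ i + t % m * s) % a
      ∎)
    where
    a∣[t/m]*m*s : a ∣ t / m * m * s
    a∣[t/m]*m*s = subst (a ∣_) (sym (*-assoc (t / m) m s)) (∣n⇒∣m*n (t / m) a∣m*s)

  term-+≡term⇒∣ : ∀ s i t d → term s i (t + d) ≡ term s i t → a ∣ d * s
  term-+≡term⇒∣ s i t d eq = [m+n]%d≡m%d⇒d∣n (toℕ i + t * s) (d * s) (begin
    (toℕ i + t * s + d * s) % a   ≡⟨ cong (_% a) (m+[n+o]*p≡m+n*p+o*p (toℕ i) s t d) ⟨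
    (toℕ i + (t + d) * s) % a     ≡⟨ toℕ-mod _ ⟨
    toℕ (term s i (t + d))        ≡⟨ cong toℕ eq ⟩
    toℕ (term s i t)              ≡⟨ toℕ-mod _ ⟩
    (toℕ i + t * s) % a           ∎)

  ∣∧<⇒≡0 : ∀ {d} → a ∣ d → d < a → d ≡ 0
  ∣∧<⇒≡0 {d} a∣d d<a = trans (sym (m<n⇒m%n≡m d<a)) (n∣m⇒m%n≡0 d a a∣d)

  coprime⇒term-injective : ∀ {s} i → Coprime s a → ∀ {t t′} → t < a → t′ < a →
                           term s i t ≡ term s i t′ → t ≡ t′
  coprime⇒term-injective {s} i s⊥a {t} {t′} t<a t′<a eq =
    [ (λ t≤t′ → ordered t≤t′ t′<a eq) , (λ t′≤t → sym (ordered t′≤t t<a (sym eq))) ]′ (≤-total t t′)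
    where
    ordered : ∀ {u v} → u ≤ v → v < a → term s i u ≡ term s i v → u ≡ v
    ordered {u} {v} u≤v v<a eq = begin
      u           ≡⟨ +-identityʳ u ⟨
      u + 0       ≡⟨ cong (u +_) d≡0 ⟨
      u + (v ∸ u) ≡⟨ m+[n∸m]≡n u≤v ⟩
      v           ∎
      where
      a∣d*s : a ∣ (v ∸ u) * s
      a∣d*s = term-+≡term⇒∣ s i u (v ∸ u) (trans (cong (term s i) (m+[n∸m]≡n u≤v)) (sym eq))
      d≡0 : v ∸ u ≡ 0
      d≡0 = ∣∧<⇒≡0 (Coprimality.coprime-divisor (Coprimality.sym s⊥a)
                      (subst (a ∣_) (*-comm (v ∸ u) s) a∣d*s))
                   (≤-<-trans (m∸n≤m v u) v<a)

  term-zero : ∀ s i → term s i 0 ≡ i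
  term-zero s i = Equivalence.from (mod≡⇔ (toℕ i + 0) i) (0 , refl)

  inProgression-period : ∀ {s m i j p} → a ∣ suc m * s →
                         InProgression s i j p → InProgression s i m p
  inProgression-period {s} {m} {i} a∣[1+m]*s inP =
    let t , _ , eq = Equivalence.to inProgression⇔ inP in
    Equivalence.from inProgression⇔
      (t % suc m , s≤s⁻¹ (m%n<n t (suc m)) , trans (sym (term-periodic a∣[1+m]*s i t)) eq)

  coprime⇒term-surjective : ∀ {s} → Coprime s a → ∀ i p → ∃[ t ] (t < a × term s i t ≡ p)
  coprime⇒term-surjective {s} s⊥a i p =
    let t , ft≡p = injective⇒surjective f-injective p in toℕ t , toℕ<n t , ft≡p
    where
    f : Fin a → Fin a
    f t = term s i (toℕ t)
    f-injective : Injective _≡_ _≡_ f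
    f-injective = toℕ-injective ∘ coprime⇒term-injective i s⊥a (toℕ<n _) (toℕ<n _)

  covering⇒≤ : ∀ s i {j} → (∀ p → ∃[ t ] (t ≤ j × term s i t ≡ p)) → a ≤ suc j
  covering⇒≤ s i {j} covers = surjective⇒≤ {f = f} f-surjective
    where
    f : Fin (suc j) → Fin a
    f t = term s i (toℕ t)
    f-surjective : ∀ p → ∃[ t ] f t ≡ p
    f-surjective p = let t , t≤j , eq = covers p in
      fromℕ< (s≤s t≤j) , trans (cong (term s i) (toℕ-fromℕ< (s≤s t≤j))) eq

-- The terms t = 1, …, a − 1 of the bijection t ↦ x + t s miss exactly the value x of t = 0.
coprime⇒inProgression-all-but : ∀ {n s} → Coprime s (2 + n) →
                                ∀ x p → p ≢ x → InProgression s (term s x 1) n p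
coprime⇒inProgression-all-but {n} {s} s⊥a x p p≢x with coprime⇒term-surjective s⊥a x p
... | zero  , _     , eq = contradiction (trans (sym eq) (term-zero s x)) p≢x
... | suc t , t<2+n , eq =
  Equivalence.from (inProgression⇔ {s = s} {i = term s x 1})
    (t , s≤s⁻¹ (s≤s⁻¹ t<2+n) , trans (term-term s x 1 t) eq)

¬coprime⇒period : ∀ {s a} → 0 < a → ¬ Coprime s a → ∃[ m ] (2 * suc m ≤ a × a ∣ suc m * s)
¬coprime⇒period {s} {a} 0<a ¬s⊥a with gcd[m,n]∣n s a | gcd[m,n]∣m s a
... | divides zero a≡0 | _ = contradiction a≡0 (>⇒≢ 0<a)
... | divides (suc m) a≡[1+m]*d | divides r s≡r*d = m , 2*[1+m]≤a , divides r [1+m]*s≡r*a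
  where
  d = gcd s a
  2≤d : 2 ≤ d
  2≤d = ≤∧≢⇒< (n≢0⇒n>0 (λ d≡0 → >⇒≢ 0<a (gcd[m,n]≡0⇒n≡0 s d≡0)))
              (λ 1≡d → ¬s⊥a (Coprimality.gcd≡1⇒coprime (sym 1≡d)))
  2*[1+m]≤a : 2 * suc m ≤ a
  2*[1+m]≤a = begin
    2 * suc m ≤⟨ *-monoˡ-≤ (suc m) 2≤d ⟩
    d * suc m ≡⟨ *-comm d (suc m) ⟩
    suc m * d ≡⟨ a≡[1+m]*d ⟨
    a         ∎
    where open ≤-Reasoning
  [1+m]*s≡r*a : suc m * s ≡ r * a
  [1+m]*s≡r*a = begin
    suc m * s       ≡⟨ cong (suc m *_) s≡r*d ⟩
    suc m * (r * d) ≡⟨ x∙yz≈y∙xz *-commutativeSemigroup (suc m) r d ⟩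
    r * (suc m * d) ≡⟨ cong (r *_) a≡[1+m]*d ⟨
    r * a           ∎
    where open ≡-Reasoning

2*m≤2+n⇒m≤n : ∀ {m n} → 2 ≤ n → 2 * m ≤ 2 + n → m ≤ n
2*m≤2+n⇒m≤n {0}     _   _ = z≤n
2*m≤2+n⇒m≤n {1}     2≤n _ = ≤-trans (n≤1+n 1) 2≤n
2*m≤2+n⇒m≤n {m@(suc (suc _))} {n} _ 2*m≤2+n = +-cancelˡ-≤ 2 m n (begin
  2 + m   ≡⟨ +-comm 2 m ⟩
  m + 2   ≤⟨ +-monoʳ-≤ m (s≤s (s≤s z≤n)) ⟩
  m + m   ≡⟨ cong (m +_) (+-identityʳ m) ⟨
  2 * m   ≤⟨ 2*m≤2+n ⟩
  2 + n   ∎)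
  where open ≤-Reasoning

∣p∣<n⇒∃∉ : ∀ {n} {p : Subset n} → ∣ p ∣ < n → ∃[ x ] x ∉ p
∣p∣<n⇒∃∉ {n} {p} ∣p∣<n = ¬∀⟶∃¬ n (_∈ p) (_∈? p) λ ⊤⊆p → <⇒≱ ∣p∣<n (begin
  n         ≡⟨ ∣⊤∣≡n n ⟨
  ∣ ⊤ {n} ∣ ≤⟨ p⊆q⇒∣p∣≤∣q∣ {p = ⊤} (λ {x} _ → ⊤⊆p x) ⟩
  ∣ p ∣     ∎)
  where open ≤-Reasoning

id-isomorphic : ∀ {P : Set} {R R′ : P → P → Set} → (∀ g g′ → R g g′ ⇔ R′ g g′) → Isomorphic R R′
id-isomorphic R⇔R′ = id , bijective _≡_ , R⇔R′

PeriodAtMost : ℕ → ℕ → ℕ → Set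
PeriodAtMost k a s = ∃[ m ] (suc m ≤ k × a ∣ suc m * s)

module _ {S : ℕ → Set} where

  ecn-mono : ∀ {a k k′} → k ≤ k′ →
             (g g′ : Position a) → ECNOption a S k g g′ → ECNOption a S k′ g g′
  ecn-mono k≤k′ _ _ (s , s∈S , i , j , j<k , move) = s , s∈S , i , j , ≤-trans j<k k≤k′ , move

  ecn-shorten : ∀ {a k k′} .{{_ : NonZero a}} → (∀ s → S s → PeriodAtMost k′ a s) →
                (g g′ : Position a) → ECNOption a S k g g′ → ECNOption a S k′ g g′
  ecn-shorten periods _ _ (s , s∈S , i , j , _ , decreases , changed⇒in) =
    let m , m<k′ , a∣[1+m]*s = periods s s∈S in
    s , s∈S , i , m , m<k′ , decreases , λ p changed →
      inProgression-period a∣[1+m]*s (changed⇒in p changed)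

  periodic⇒ecn⇔ecn : ∀ {a k k′} .{{_ : NonZero a}} → (∀ s → S s → PeriodAtMost k′ a s) →
                     k′ ≤ k → (g g′ : Position a) → ECNOption a S k g g′ ⇔ ECNOption a S k′ g g′
  periodic⇒ecn⇔ecn periods k′≤k g g′ = mk⇔ (ecn-shorten periods g g′) (ecn-mono k′≤k g g′)

  decreases⇒ecn : ∀ {n s} → S s → Coprime s (suc n) →
                  (g g′ : Position (suc n)) → Decreases g g′ → ECNOption (suc n) S (suc n) g g′
  decreases⇒ecn {n} {s} s∈S s⊥a _ _ decreases = s , s∈S , zero , n , n<1+n n , decreases , λ p _ →
    let t , t<1+n , eq = coprime⇒term-surjective s⊥a zero p in
    Equivalence.from inProgression⇔ (t , s≤s⁻¹ t<1+n , eq)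

  decreases⇒mn : ∀ {a} (g g′ : Position a) → Decreases g g′ → MNOption a a g g′
  decreases⇒mn {a} _ _ decreases = ⊤ , ≤-reflexive (∣⊤∣≡n a) , decreases , λ _ _ → ∈⊤

  coprime⇒ecn⇔mn : ∀ {n s} → S s → Coprime s (suc n) → (g g′ : Position (suc n)) →
                   ECNOption (suc n) S (suc n) g g′ ⇔ MNOption (suc n) (suc n) g g′
  coprime⇒ecn⇔mn s∈S s⊥a g g′ = mk⇔
    (λ (_ , _ , _ , _ , _ , decreases , _) → decreases⇒mn g g′ decreases)
    (λ (_ , _ , decreases , _) → decreases⇒ecn s∈S s⊥a g g′ decreases)

  ecn⇒unchanged : ∀ {n k} → k ≤ n → (g g′ : Position (suc n)) → ECNOption (suc n) S k g g′ →
                  ∃[ x ] lookup g′ x ≡ lookup g x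
  ecn⇒unchanged k≤n g g′ (s , _ , i , j , j<k , _ , changed⇒in)
    with any? (λ p → lookup g′ p ≟ lookup g p)
  ... | yes unchanged = unchanged
  ... | no ¬unchanged = contradiction (covering⇒≤ s i covers) (<⇒≱ (s≤s (≤-trans j<k k≤n)))
    where
    covers : ∀ p → ∃[ t ] (t ≤ j × term s i t ≡ p)
    covers p = Equivalence.to (inProgression⇔ {s = s} {i = i})
                              (changed⇒in p λ eq → ¬unchanged (p , eq))

  unchanged⇒mn : ∀ {n} (g g′ : Position (suc n)) x → lookup g′ x ≡ lookup g x →
                 Decreases g g′ → MNOption (suc n) n g g′
  unchanged⇒mn {n} g g′ x unchanged decreases =
    ∁ ⁅ x ⁆ , ∣∁⁅x⁆∣≤n , decreases , λ p shrinks → x∉p⇒x∈∁p λ p∈⁅x⁆ →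
      <⇒≢ shrinks (subst (λ q → lookup g′ q ≡ lookup g q) (sym (x∈⁅y⁆⇒x≡y x p∈⁅x⁆)) unchanged)
    where
    ∣∁⁅x⁆∣≤n : ∣ ∁ ⁅ x ⁆ ∣ ≤ n
    ∣∁⁅x⁆∣≤n = ≤-reflexive (trans (∣∁p∣≡n∸∣p∣ ⁅ x ⁆) (cong (suc n ∸_) (∣⁅x⁆∣≡1 x)))

  mn⇒ecn-pred : ∀ {n s} → S s → Coprime s (2 + n) → (g g′ : Position (2 + n)) →
                MNOption (2 + n) (suc n) g g′ → ECNOption (2 + n) S (suc n) g g′
  mn⇒ecn-pred {n} {s} s∈S s⊥a g g′ (T , ∣T∣≤1+n , decreases , shrinks⇒∈T)
    with x , x∉T ← ∣p∣<n⇒∃∉ {p = T} (s≤s ∣T∣≤1+n) =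
    s , s∈S , term s x 1 , n , n<1+n n , decreases , λ p changed →
      coprime⇒inProgression-all-but s⊥a x p λ { refl →
        x∉T (shrinks⇒∈T p (≤∧≢⇒< (proj₁ decreases p) changed)) }

  coprime⇒ecn⇔mn-pred : ∀ {n s} → S s → Coprime s (2 + n) → (g g′ : Position (2 + n)) →
                        ECNOption (2 + n) S (suc n) g g′ ⇔ MNOption (2 + n) (suc n) g g′
  coprime⇒ecn⇔mn-pred s∈S s⊥a g g′ = mk⇔
    (λ move@(_ , _ , _ , _ , _ , decreases , _) →
      let x , unchanged = ecn⇒unchanged ≤-refl g g′ move in unchanged⇒mn g g′ x unchanged decreases)
    (mn⇒ecn-pred s∈S s⊥a g g′)

mainTheorem1 : (a : ℕ) → 4 ≤ a → (S : ℕ → Set) →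
    ((s : ℕ) → S s → 1 ≤ s × 2 * s ≤ a) → ∃[ s ] S s →
    (((∃[ s ] (S s × Coprime s a)) →
        Isomorphic (ECNOption a S (a ∸ 1)) (MNOption a (a ∸ 1)))
     × ((¬ (∃[ s ] (S s × Coprime s a))) →
        Isomorphic (ECNOption a S (a ∸ 1)) (ECNOption a S (a ∸ 2))))
    × (((∃[ s ] (S s × Coprime s a)) →
        Isomorphic (ECNOption a S a) (MNOption a a))
     × ((¬ (∃[ s ] (S s × Coprime s a))) →
        Isomorphic (ECNOption a S a) (ECNOption a S (a ∸ 2))))
mainTheorem1 (suc (suc n)) (s≤s (s≤s 2≤n)) S _ _ =
  ( (λ (_ , s∈S , s⊥a) → id-isomorphic (coprime⇒ecn⇔mn-pred s∈S s⊥a))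
  , (λ ¬coprime → id-isomorphic (periodic⇒ecn⇔ecn (periods ¬coprime) (n≤1+n n))) )
  , ( (λ (_ , s∈S , s⊥a) → id-isomorphic (coprime⇒ecn⇔mn s∈S s⊥a))
    , (λ ¬coprime → id-isomorphic (periodic⇒ecn⇔ecn (periods ¬coprime) (m≤n+m n 2))) )
  where
  periods : ¬ (∃[ s ] (S s × Coprime s (2 + n))) → ∀ s → S s → PeriodAtMost n (2 + n) s
  periods ¬coprime s s∈S =
    let m , 2*[1+m]≤2+n , 2+n∣[1+m]*s = ¬coprime⇒period z<s λ s⊥a → ¬coprime (s , s∈S , s⊥a) in
    m , 2*m≤2+n⇒m≤n 2≤n 2*[1+m]≤2+n , 2+n∣[1+m]*s
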